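{- Let $k$ be a positive integer, $h(z)=\lfloor z/(2k)\rfloor$, $s$ a positive integer, and $h_s(z)=\lfloor (z+s)/(2k)\rfloor$. Then $s=m2^v$ for some $v,m\in\mathbb{Z}_{\ge0}$ with $m\in\{0,1,2,\dots,2k-1\}$ if and only if $G_{h_s}(\{y,z\})=(y\oplus(z+s))-s$ for all $y,z\in\mathbb{Z}_{\ge0}$ with $y\le h_s(z)$.
   Context: $\oplus$ denotes nim-sum (bitwise XOR). For a nondecreasing $f:\mathbb{Z}_{\ge0}\to\mathbb{Z}_{\ge0}$, positions of the chocolate bar game $CB(f,y,z)$ are pairs $\{y,z\}$ with $y\le f(z)$ (bar with $z+1$ columns, column 0 bitter, column $i$ of height $\min(f(i),y)+1$). Moves: $move_f(\{y,z\})=\{\{v,z\}:v<y\}\cup\{\{\min(y,f(w)),w\}:w<z\}$. Grundy number: $G_f(\{y,z\})=\mathrm{mex}\{G_f(p):p\in move_f(\{y,z\})\}$, mex being the least nonnegative integer not in the set. -}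

module Defs where

open import Data.Nat.Base using (ℕ; zero; suc; _+_; _*_; _⊓_; _/_; _%_; NonZero)
open import Data.Nat.Properties using (_≟_)
open import Data.Bool.Base using (Bool; true; false; if_then_else_)
open import Data.List.Base using (List; []; _∷_; _++_; [_]; length; map; zip; upTo)
open import Data.List.Membership.DecPropositional _≟_ using (_∈?_)
open import Data.Product.Base using (_,_)
open import Relation.Nullary.Decidable.Core using (does)

-- Nim-sum (bitwise XOR) on ℕ.
-- xorF fuel m n processes `fuel` binary digits; fuel = m + n suffices
-- (a number x has at most x binary digits), so _⊕_ is the true XOR.

xorF : ℕ → ℕ → ℕ → ℕ
xorF zero    m n = 0
xorF (suc f) m n =
  (if does ((m % 2) ≟ (n % 2)) then 0 else 1) + 2 * xorF f (m / 2) (n / 2)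

infixl 6 _⊕_
_⊕_ : ℕ → ℕ → ℕ
m ⊕ n = xorF (m + n) m n

-- mex: least natural number not in the list.
-- Searching upwards from 0 with fuel (length l + 1) always finds it,
-- since among 0..length l some number is missing from l.

mexFrom : ℕ → ℕ → List ℕ → ℕ
mexFrom zero    n l = n
mexFrom (suc f) n l = if does (n ∈? l) then mexFrom f (suc n) l else n

mex : List ℕ → ℕ
mex l = mexFrom (suc (length l)) 0 l

-- Grundy numbers of the chocolate bar game CB(f,y,z).
-- move_f({y,z}) = {{v,z} : v < y} ∪ {{min(y,f w), w} : w < z}.
-- We compute by course-of-values recursion: `columns f z` is the list
-- [G_f(·,0), …, G_f(·,z-1)] of column functions y ↦ G_f({y,w}).

module _ (f : ℕ → ℕ) where

  horizontal : List (ℕ → ℕ) → ℕ → List ℕ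
  horizontal prev y = map (λ { (w , g) → g (y ⊓ f w) }) (zip (upTo (length prev)) prev)

  vertical : List (ℕ → ℕ) → ℕ → List ℕ
  vertical prev zero    = []
  vertical prev (suc y) =
    vertical prev y ++ [ mex (vertical prev y ++ horizontal prev y) ]

  column : List (ℕ → ℕ) → ℕ → ℕ
  column prev y = mex (vertical prev y ++ horizontal prev y)

  columns : ℕ → List (ℕ → ℕ)
  columns zero    = []
  columns (suc z) = columns z ++ [ column (columns z) ]

G : (ℕ → ℕ) → ℕ → ℕ → ℕ
G f y z = column f (columns f z) y

-- h_s(z) = ⌊(z + s) / (2k)⌋   (k is assumed positive in the theorem;
-- the value at k = 0 is an irrelevant junk value 0).

hs : ℕ → ℕ → ℕ → ℕ
hs zero    s z = 0
hs (suc k) s z = (z + s) / (2 * suc k)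

-- Write K = 2k and t = z + s, so that h_s(z) = ⌊t/K⌋ and the claimed Grundy value of {y,z} is
-- (y ⊕ t) − s.  A labelling of the positions that satisfies the mex recursion is the Grundy
-- function, so for s = m·2^v with m < K it suffices to show, for every position y ≤ ⌊t/K⌋:
--   * s ≤ y ⊕ t: above bit v, the high parts Y of y and T of t satisfy m + Y ≤ T;
--   * vertical moves change y ⊕ t, since ⊕ is injective;
--   * a horizontal move to {min(y,⌊t'/K⌋), t'} with t' < t changes it as well: otherwise
--     ⌊t'/K⌋ ⊕ t' = y ⊕ t, so t', t and ⌊t'/K⌋, y first differ in the same bit j, and
--     because K is even this forces ⌊t'/K⌋ ≥ y;
--   * every s ≤ u < y ⊕ t is reached: let j be the highest bit in which u and y ⊕ t differ.
--     If y has bit j, the vertical move to u ⊕ t works as in Nim.  Otherwise t has bit j, and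
--     the horizontal moves to the 2^j columns t' that agree with t above bit j and have bit j
--     clear take pairwise distinct values (previous point) in a block of 2^j values containing u.
-- Conversely, if s = m·2^v with m odd and m ≥ K, then {2^v, 0} is a position while
-- 2^v ⊕ s < s, so the formula would give a negative value.

module Submission where

open import Defs
open import Data.Nat.Base using (ℕ; _+_; _*_; _^_; _≤_; _<_)
open import Data.Integer.Base using (ℤ; +_; _-_)
open import Data.Product.Base using (Σ; _×_)
open import Relation.Binary.PropositionalEquality using (_≡_)
open import Function.Bundles using (_⇔_)
open import Data.Nat.Base
open import Data.Nat.Properties
open import Data.Nat.DivMod
open import Data.Nat.Tactic.RingSolver using (solve-∀)
open import Data.Bool.Base using (true; false; if_then_else_)
open import Data.Fin.Base using (Fin; toℕ; fromℕ<; punchOut)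
open import Data.Fin.Properties using (toℕ<n; toℕ-fromℕ<; any?; pigeonhole; punchOut-injective) renaming (_≟_ to _≟ᶠ_)
open import Data.Integer.Base using (_⊖_)
open import Data.Integer.Properties using (m-n≡m⊖n; ⊖-≥; ⊖-<)
open import Data.List.Base using (List; _∷_; _++_; [_]; length; zip; applyUpTo)
open import Data.List.Properties using (applyUpTo-∷ʳ; map-applyUpTo; length-applyUpTo; length-++)
open import Data.List.Membership.Propositional using (_∈_; _∉_)
open import Data.List.Membership.Propositional.Properties using (∈-++⁺ˡ; ∈-++⁺ʳ; ∈-++⁻; ∈-applyUpTo⁺; ∈-applyUpTo⁻)
open import Data.List.Membership.DecPropositional _≟_ using (_∈?_)
open import Data.Nat.Induction using (<-rec)
open import Data.Product.Base using (∃; ∃-syntax; _,_; proj₁; proj₂)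
open import Data.Sum.Base using (_⊎_; inj₁; inj₂)
open import Function.Base using (_∘_)
open import Function.Bundles using (mk⇔)
open import Relation.Binary.Definitions using (tri<; tri≈; tri>)
open import Relation.Binary.PropositionalEquality hiding ([_])
open import Relation.Nullary using (Dec; yes; no; ¬_; contradiction)
open import Relation.Nullary.Decidable.Core using (does)

divMod-unique : ∀ d q r .{{_ : NonZero d}} → r < d → (r + q * d) / d ≡ q × (r + q * d) % d ≡ r
divMod-unique d q r r<d = quotient , remainder
  where
  remainder : (r + q * d) % d ≡ r
  remainder = trans ([m+kn]%n≡m%n r q d) (m<n⇒m%n≡m r<d)
  noCarry : r % d + q * d % d < d
  noCarry = subst₂ (λ a b → a + b < d) (sym (m<n⇒m%n≡m r<d)) (sym (m*n%n≡0 q d)) (subst (_< d) (sym (+-identityʳ r)) r<d)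
  quotient : (r + q * d) / d ≡ q
  quotient = trans (+-distrib-/ r (q * d) noCarry) (cong₂ _+_ (m<n⇒m/n≡0 r<d) (m*n/n≡m q d))

m≡[m/n]*n+m%n : ∀ m n .{{_ : NonZero n}} → m ≡ m / n * n + m % n
m≡[m/n]*n+m%n m n = trans (m≡m%n+[m/n]*n m n) (+-comm (m % n) _)

quotRem-unique : ∀ d {q r q' r'} .{{_ : NonZero d}} → r < d → r' < d →
  q * d + r ≡ q' * d + r' → q ≡ q' × r ≡ r'
quotRem-unique d {q} {r} {q'} {r'} r< r'< eq with divMod-unique d q r r< | divMod-unique d q' r' r'<
... | q≡ , r≡ | q'≡ , r'≡ = trans (sym q≡) (trans (cong (_/ d) eq') q'≡) , trans (sym r≡) (trans (cong (_% d) eq') r'≡)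
  where
  eq' : r + q * d ≡ r' + q' * d
  eq' = trans (+-comm r (q * d)) (trans eq (+-comm (q' * d) r'))

*≤⇒≤/ : ∀ {a n} d .{{_ : NonZero d}} → a * d ≤ n → a ≤ n / d
*≤⇒≤/ {a} {n} d le = subst (_≤ n / d) (m*n/n≡m a d) (/-monoˡ-≤ d le)

≤/⇒*≤ : ∀ {a n} d .{{_ : NonZero d}} → a ≤ n / d → a * d ≤ n
≤/⇒*≤ {a} {n} d le = ≤-trans (*-monoˡ-≤ d le) (m/n*n≤m n d)

*-rightComm : ∀ a b c → a * b * c ≡ a * c * b
*-rightComm = solve-∀

m*o<[1+n]*o⇒m≤n : ∀ o {m n} → m * o < suc n * o → m ≤ n
m*o<[1+n]*o⇒m≤n o {m} {n} lt = s≤s⁻¹ (*-cancelʳ-< o m (suc n) lt)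

halve : ∀ m → m ≡ m % 2 + 2 * (m / 2)
halve m = trans (m≡m%n+[m/n]*n m 2) (cong (_+_ (m % 2)) (*-comm (m / 2) 2))

double≤suc⇒≤ : ∀ {x n} → x + x ≤ suc n → x ≤ n
double≤suc⇒≤ {zero}  _ = z≤n
double≤suc⇒≤ {suc x} (s≤s le) = ≤-trans (m≤n+m (suc x) x) le

[m/2]+[m/2]≤m : ∀ m → m / 2 + m / 2 ≤ m
[m/2]+[m/2]≤m m = subst (_≤ m) (double (m / 2)) (m/n*n≤m m 2)
  where
  double : ∀ a → a * 2 ≡ a + a
  double = solve-∀

+-double-mono : ∀ {a b} x y → x + x ≤ a → y + y ≤ b → (x + y) + (x + y) ≤ a + b
+-double-mono {a} {b} x y p q = subst (_≤ a + b) (interchange x y) (+-mono-≤ p q)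
  where
  interchange : ∀ x y → (x + x) + (y + y) ≡ (x + y) + (x + y)
  interchange = solve-∀

halves-≤ : ∀ m n → (m / 2 + n / 2) + (m / 2 + n / 2) ≤ m + n
halves-≤ m n = +-double-mono (m / 2) (n / 2) ([m/2]+[m/2]≤m m) ([m/2]+[m/2]≤m n)

halving-induction : (P : ℕ → ℕ → ℕ → Set) → P 0 0 0 →
  (∀ l m n → P (l / 2) (m / 2) (n / 2) → P l m n) → ∀ l m n → P l m n
halving-induction P base step l m n = go (l + m + n) l m n ≤-refl
  where
  go : ∀ fuel l m n → l + m + n ≤ fuel → P l m n
  go zero zero zero zero _ = base
  go (suc fuel) l m n le = step l m n (go fuel (l / 2) (m / 2) (n / 2) (double≤suc⇒≤ (≤-trans halves le)))
    where
    halves : (l / 2 + m / 2 + n / 2) + (l / 2 + m / 2 + n / 2) ≤ l + m + n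
    halves = +-double-mono (l / 2 + m / 2) (n / 2) (halves-≤ l m) ([m/2]+[m/2]≤m n)

halving-induction₂ : (P : ℕ → ℕ → Set) → P 0 0 → (∀ m n → P (m / 2) (n / 2) → P m n) → ∀ m n → P m n
halving-induction₂ P base step m n = halving-induction (λ m n _ → P m n) base (λ m n _ → step m n) m n 0

halving-induction₁ : (P : ℕ → Set) → P 0 → (∀ m → P (m / 2) → P m) → ∀ m → P m
halving-induction₁ P base step m = halving-induction₂ (λ m _ → P m) base (λ m _ → step m) m 0

-- Nim-sum

-- The digit computed by xorF, so that ⊕-unfold holds by unfolding the definitions.
bitXor : ℕ → ℕ → ℕ
bitXor a b = if does (a ≟ b) then 0 else 1

xorF-0 : ∀ f → xorF f 0 0 ≡ 0
xorF-0 zero    = refl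
xorF-0 (suc f) = cong (2 *_) (xorF-0 f)

xorF-fuel : ∀ {f g} m n → m + n ≤ f → m + n ≤ g → xorF f m n ≡ xorF g m n
xorF-fuel {f} {g} zero zero _ _ = trans (xorF-0 f) (sym (xorF-0 g))
xorF-fuel {suc f} {suc g} m n p q = cong (λ x → bitXor (m % 2) (n % 2) + 2 * x)
  (xorF-fuel (m / 2) (n / 2) (double≤suc⇒≤ (≤-trans (halves-≤ m n) p)) (double≤suc⇒≤ (≤-trans (halves-≤ m n) q)))
xorF-fuel {zero}  zero    (suc n) () _
xorF-fuel {zero}  (suc m) n       () _
xorF-fuel {suc f} {zero} zero    (suc n) _ ()
xorF-fuel {suc f} {zero} (suc m) n       _ ()

⊕-unfold : ∀ m n → m ⊕ n ≡ bitXor (m % 2) (n % 2) + 2 * (m / 2 ⊕ n / 2)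
⊕-unfold m n = trans (xorF-fuel m n ≤-refl (n≤1+n _))
  (cong (λ x → bitXor (m % 2) (n % 2) + 2 * x) (xorF-fuel (m / 2) (n / 2) halves≤ ≤-refl))
  where
  halves≤ : m / 2 + n / 2 ≤ m + n
  halves≤ = ≤-trans (m≤m+n _ _) (halves-≤ m n)

data Bit : ℕ → Set where
  0ᵇ : Bit 0
  1ᵇ : Bit 1

bit : ∀ m → Bit (m % 2)
bit m with m % 2 | m%n<n m 2
... | 0           | _              = 0ᵇ
... | 1           | _              = 1ᵇ
... | suc (suc _) | s≤s (s≤s ())

Bit⇒<2 : ∀ {b} → Bit b → b < 2
Bit⇒<2 0ᵇ = s≤s z≤n
Bit⇒<2 1ᵇ = s≤s (s≤s z≤n)

<2⇒Bit : ∀ {b} → b < 2 → Bit b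
<2⇒Bit {0} _ = 0ᵇ
<2⇒Bit {1} _ = 1ᵇ
<2⇒Bit {suc (suc _)} (s≤s (s≤s ()))

bitXor<2 : ∀ a b → bitXor a b < 2
bitXor<2 a b with does (a ≟ b)
... | true  = s≤s z≤n
... | false = s≤s (s≤s z≤n)

bitXor-comm : ∀ {a b} → Bit a → Bit b → bitXor a b ≡ bitXor b a
bitXor-comm 0ᵇ 0ᵇ = refl
bitXor-comm 0ᵇ 1ᵇ = refl
bitXor-comm 1ᵇ 0ᵇ = refl
bitXor-comm 1ᵇ 1ᵇ = refl

bitXor-assoc : ∀ {a b c} → Bit a → Bit b → Bit c → bitXor (bitXor a b) c ≡ bitXor a (bitXor b c)
bitXor-assoc 0ᵇ 0ᵇ 0ᵇ = refl
bitXor-assoc 0ᵇ 0ᵇ 1ᵇ = refl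
bitXor-assoc 0ᵇ 1ᵇ 0ᵇ = refl
bitXor-assoc 0ᵇ 1ᵇ 1ᵇ = refl
bitXor-assoc 1ᵇ 0ᵇ 0ᵇ = refl
bitXor-assoc 1ᵇ 0ᵇ 1ᵇ = refl
bitXor-assoc 1ᵇ 1ᵇ 0ᵇ = refl
bitXor-assoc 1ᵇ 1ᵇ 1ᵇ = refl

bitXor-identityʳ : ∀ {a} → Bit a → bitXor a 0 ≡ a
bitXor-identityʳ 0ᵇ = refl
bitXor-identityʳ 1ᵇ = refl

bitXor-self : ∀ {a} → Bit a → bitXor a a ≡ 0
bitXor-self 0ᵇ = refl
bitXor-self 1ᵇ = refl

bitXor≤+ : ∀ {a b} → Bit a → Bit b → bitXor a b ≤ a + b
bitXor≤+ 0ᵇ 0ᵇ = z≤n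
bitXor≤+ 0ᵇ 1ᵇ = ≤-refl
bitXor≤+ 1ᵇ 0ᵇ = ≤-refl
bitXor≤+ 1ᵇ 1ᵇ = z≤n

lowDigit : ∀ r q → r < 2 → (r + 2 * q) % 2 ≡ r × (r + 2 * q) / 2 ≡ q
lowDigit r q r<2 with divMod-unique 2 q r r<2
... | quotient , remainder rewrite *-comm q 2 = remainder , quotient

⊕-digits : ∀ r r' a b → r < 2 → r' < 2 → (r + 2 * a) ⊕ (r' + 2 * b) ≡ bitXor r r' + 2 * (a ⊕ b)
⊕-digits r r' a b r<2 r'<2 with lowDigit r a r<2 | lowDigit r' b r'<2
... | r%2 , a/2 | r'%2 , b/2 = trans (⊕-unfold (r + 2 * a) (r' + 2 * b))
  (cong₂ (λ x y → x + 2 * y) (cong₂ bitXor r%2 r'%2) (cong₂ _⊕_ a/2 b/2))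

⊕-bit0 : ∀ m n → (m ⊕ n) % 2 ≡ bitXor (m % 2) (n % 2)
⊕-bit0 m n = trans (cong (_% 2) (⊕-unfold m n)) (proj₁ (lowDigit _ (m / 2 ⊕ n / 2) (bitXor<2 (m % 2) (n % 2))))

⊕-half : ∀ m n → (m ⊕ n) / 2 ≡ m / 2 ⊕ n / 2
⊕-half m n = trans (cong (_/ 2) (⊕-unfold m n)) (proj₂ (lowDigit _ (m / 2 ⊕ n / 2) (bitXor<2 (m % 2) (n % 2))))

⊕-comm : ∀ m n → m ⊕ n ≡ n ⊕ m
⊕-comm = halving-induction₂ (λ m n → m ⊕ n ≡ n ⊕ m) refl λ m n ih → begin
  m ⊕ n                                    ≡⟨ ⊕-unfold m n ⟩
  bitXor (m % 2) (n % 2) + 2 * (m / 2 ⊕ n / 2) ≡⟨ cong₂ (λ x y → x + 2 * y) (bitXor-comm (bit m) (bit n)) ih ⟩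
  bitXor (n % 2) (m % 2) + 2 * (n / 2 ⊕ m / 2) ≡⟨ ⊕-unfold n m ⟨
  n ⊕ m                                    ∎
  where open ≡-Reasoning

⊕-identityʳ : ∀ m → m ⊕ 0 ≡ m
⊕-identityʳ = halving-induction₁ (λ m → m ⊕ 0 ≡ m) refl λ m ih →
  trans (⊕-unfold m 0) (trans (cong₂ (λ x y → x + 2 * y) (bitXor-identityʳ (bit m)) ih) (sym (halve m)))

⊕-identityˡ : ∀ m → 0 ⊕ m ≡ m
⊕-identityˡ m = trans (⊕-comm 0 m) (⊕-identityʳ m)

⊕-self : ∀ m → m ⊕ m ≡ 0
⊕-self = halving-induction₁ (λ m → m ⊕ m ≡ 0) refl λ m ih →
  trans (⊕-unfold m m) (cong₂ (λ x y → x + 2 * y) (bitXor-self (bit m)) ih)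

⊕-assoc : ∀ l m n → (l ⊕ m) ⊕ n ≡ l ⊕ (m ⊕ n)
⊕-assoc = halving-induction (λ l m n → (l ⊕ m) ⊕ n ≡ l ⊕ (m ⊕ n)) refl λ l m n ih → begin
  (l ⊕ m) ⊕ n
    ≡⟨ ⊕-unfold (l ⊕ m) n ⟩
  bitXor ((l ⊕ m) % 2) (n % 2) + 2 * ((l ⊕ m) / 2 ⊕ n / 2)
    ≡⟨ cong₂ (λ x y → bitXor x (n % 2) + 2 * (y ⊕ n / 2)) (⊕-bit0 l m) (⊕-half l m) ⟩
  bitXor (bitXor (l % 2) (m % 2)) (n % 2) + 2 * ((l / 2 ⊕ m / 2) ⊕ n / 2)
    ≡⟨ cong₂ (λ x y → x + 2 * y) (bitXor-assoc (bit l) (bit m) (bit n)) ih ⟩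
  bitXor (l % 2) (bitXor (m % 2) (n % 2)) + 2 * (l / 2 ⊕ (m / 2 ⊕ n / 2))
    ≡⟨ cong₂ (λ x y → bitXor (l % 2) x + 2 * (l / 2 ⊕ y)) (⊕-bit0 m n) (⊕-half m n) ⟨
  bitXor (l % 2) ((m ⊕ n) % 2) + 2 * (l / 2 ⊕ (m ⊕ n) / 2)
    ≡⟨ ⊕-unfold l (m ⊕ n) ⟨
  l ⊕ (m ⊕ n) ∎
  where open ≡-Reasoning

⊕-cancelʳ : ∀ m n → (m ⊕ n) ⊕ n ≡ m
⊕-cancelʳ m n = trans (⊕-assoc m n n) (trans (cong (m ⊕_) (⊕-self n)) (⊕-identityʳ m))

⊕-cancelˡ : ∀ m n → m ⊕ (m ⊕ n) ≡ n
⊕-cancelˡ m n = trans (⊕-comm m (m ⊕ n)) (trans (cong (_⊕ m) (⊕-comm m n)) (⊕-cancelʳ n m))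

⊕-injectiveˡ : ∀ {m m'} n → m ⊕ n ≡ m' ⊕ n → m ≡ m'
⊕-injectiveˡ {m} {m'} n eq = trans (sym (⊕-cancelʳ m n)) (trans (cong (_⊕ n) eq) (⊕-cancelʳ m' n))

⊕-injectiveʳ : ∀ m {n n'} → m ⊕ n ≡ m ⊕ n' → n ≡ n'
⊕-injectiveʳ m {n} {n'} eq = trans (sym (⊕-cancelˡ m n)) (trans (cong (m ⊕_) eq) (⊕-cancelˡ m n'))

⊕-exchange : ∀ {a b c d} → a ⊕ b ≡ c ⊕ d → c ⊕ a ≡ d ⊕ b
⊕-exchange {a} {b} {c} {d} eq = begin
  c ⊕ a               ≡⟨ cong (c ⊕_) (⊕-cancelʳ a b) ⟨
  c ⊕ ((a ⊕ b) ⊕ b)   ≡⟨ cong (λ x → c ⊕ (x ⊕ b)) eq ⟩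
  c ⊕ ((c ⊕ d) ⊕ b)   ≡⟨ ⊕-assoc c (c ⊕ d) b ⟨
  (c ⊕ (c ⊕ d)) ⊕ b   ≡⟨ cong (_⊕ b) (⊕-cancelˡ c d) ⟩
  d ⊕ b               ∎
  where open ≡-Reasoning

⊕≤+ : ∀ m n → m ⊕ n ≤ m + n
⊕≤+ = halving-induction₂ (λ m n → m ⊕ n ≤ m + n) z≤n λ m n ih → begin
  m ⊕ n                                        ≡⟨ ⊕-unfold m n ⟩
  bitXor (m % 2) (n % 2) + 2 * (m / 2 ⊕ n / 2) ≤⟨ +-mono-≤ (bitXor≤+ (bit m) (bit n)) (*-monoʳ-≤ 2 ih) ⟩
  (m % 2 + n % 2) + 2 * (m / 2 + n / 2)        ≡⟨ regroup (m % 2) (n % 2) (m / 2) (n / 2) ⟩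
  (m % 2 + 2 * (m / 2)) + (n % 2 + 2 * (n / 2)) ≡⟨ cong₂ _+_ (halve m) (halve n) ⟨
  m + n                                        ∎
  where
  open ≤-Reasoning
  regroup : ∀ a b c d → (a + b) + 2 * (c + d) ≡ (a + 2 * c) + (b + 2 * d)
  regroup = solve-∀

≤⊕+ : ∀ m n → m ≤ (m ⊕ n) + n
≤⊕+ m n = subst (_≤ (m ⊕ n) + n) (⊕-cancelʳ m n) (⊕≤+ (m ⊕ n) n)

m+y≤t⇒m≤y⊕t : ∀ {m y t} → m + y ≤ t → m ≤ y ⊕ t
m+y≤t⇒m≤y⊕t {m} {y} {t} le = +-cancelʳ-≤ y m (y ⊕ t) (begin
  m + y         ≤⟨ le ⟩
  t             ≤⟨ ≤⊕+ t y ⟩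
  (t ⊕ y) + y   ≡⟨ cong (_+ y) (⊕-comm t y) ⟩
  (y ⊕ t) + y   ∎)
  where open ≤-Reasoning

c+2w<2p : ∀ {c w p} → c < 2 → w < p → c + 2 * w < 2 * p
c+2w<2p {c} {w} {p} c<2 w<p = begin-strict
  c + 2 * w   <⟨ +-monoˡ-< (2 * w) c<2 ⟩
  2 + 2 * w   ≡⟨ *-distribˡ-+ 2 1 w ⟨
  2 * suc w   ≤⟨ *-monoʳ-≤ 2 w<p ⟩
  2 * p       ∎
  where open ≤-Reasoning

half<2^ : ∀ {a} j → a < 2 ^ suc j → a / 2 < 2 ^ j
half<2^ {a} j a< = m<n*o⇒m/o<n (subst (a <_) (*-comm 2 (2 ^ j)) a<)

⊕-<-2^ : ∀ j {a b} → a < 2 ^ j → b < 2 ^ j → a ⊕ b < 2 ^ j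
⊕-<-2^ zero (s≤s z≤n) (s≤s z≤n) = s≤s z≤n
⊕-<-2^ (suc j) {a} {b} a< b< = subst (_< 2 ^ suc j) (sym (⊕-unfold a b))
  (c+2w<2p (bitXor<2 (a % 2) (b % 2)) (⊕-<-2^ j (half<2^ j a<) (half<2^ j b<)))

⊕-split : ∀ j X Y {a b} → a < 2 ^ j → b < 2 ^ j →
  (X * 2 ^ j + a) ⊕ (Y * 2 ^ j + b) ≡ (X ⊕ Y) * 2 ^ j + (a ⊕ b)
⊕-split zero X Y (s≤s z≤n) (s≤s z≤n) = begin
  (X * 1 + 0) ⊕ (Y * 1 + 0) ≡⟨ cong₂ _⊕_ (x*1+0≡x X) (x*1+0≡x Y) ⟩
  X ⊕ Y                     ≡⟨ x*1+0≡x (X ⊕ Y) ⟨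
  (X ⊕ Y) * 1 + 0           ∎
  where
  open ≡-Reasoning
  x*1+0≡x : ∀ x → x * 1 + 0 ≡ x
  x*1+0≡x x = trans (+-identityʳ (x * 1)) (*-identityʳ x)
⊕-split (suc j) X Y {a} {b} a< b< = begin
  (X * 2 ^ suc j + a) ⊕ (Y * 2 ^ suc j + b)
    ≡⟨ cong₂ _⊕_ (shiftOut X a) (shiftOut Y b) ⟩
  (a % 2 + 2 * (X * 2 ^ j + a / 2)) ⊕ (b % 2 + 2 * (Y * 2 ^ j + b / 2))
    ≡⟨ ⊕-digits (a % 2) (b % 2) (X * 2 ^ j + a / 2) (Y * 2 ^ j + b / 2) (m%n<n a 2) (m%n<n b 2) ⟩
  bitXor (a % 2) (b % 2) + 2 * ((X * 2 ^ j + a / 2) ⊕ (Y * 2 ^ j + b / 2))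
    ≡⟨ cong (λ z → bitXor (a % 2) (b % 2) + 2 * z) (⊕-split j X Y (half<2^ j a<) (half<2^ j b<)) ⟩
  bitXor (a % 2) (b % 2) + 2 * ((X ⊕ Y) * 2 ^ j + (a / 2 ⊕ b / 2))
    ≡⟨ shiftIn (X ⊕ Y) (2 ^ j) (bitXor (a % 2) (b % 2)) (a / 2 ⊕ b / 2) ⟩
  (X ⊕ Y) * 2 ^ suc j + (bitXor (a % 2) (b % 2) + 2 * (a / 2 ⊕ b / 2))
    ≡⟨ cong (_+_ ((X ⊕ Y) * 2 ^ suc j)) (⊕-unfold a b) ⟨
  (X ⊕ Y) * 2 ^ suc j + (a ⊕ b) ∎
  where
  open ≡-Reasoning
  shiftIn : ∀ Z p c w → c + 2 * (Z * p + w) ≡ Z * (2 * p) + (c + 2 * w)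
  shiftIn = solve-∀
  shiftOut : ∀ Z c → Z * 2 ^ suc j + c ≡ c % 2 + 2 * (Z * 2 ^ j + c / 2)
  shiftOut Z c = trans (cong (_+_ (Z * 2 ^ suc j)) (halve c)) (sym (shiftIn Z (2 ^ j) (c % 2) (c / 2)))

-- Binary expansions

2^j+a<2^[1+j] : ∀ j {a} → a < 2 ^ j → 2 ^ j + a < 2 ^ suc j
2^j+a<2^[1+j] j {a} a< = subst (2 ^ j + a <_) (cong (_+_ (2 ^ j)) (sym (+-identityʳ (2 ^ j)))) (+-monoʳ-< (2 ^ j) a<)

2^j<2^[1+j] : ∀ j → 2 ^ j < 2 ^ suc j
2^j<2^[1+j] j = subst (_< 2 ^ suc j) (+-identityʳ (2 ^ j)) (2^j+a<2^[1+j] j (m^n>0 2 j))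

record HighestDifferingBit (x x' : ℕ) : Set where
  constructor differ
  field
    j high low low' : ℕ
    low<  : low < 2 ^ j
    low'< : low' < 2 ^ j
    x≡    : x ≡ high * 2 ^ suc j + low
    x'≡   : x' ≡ high * 2 ^ suc j + 2 ^ j + low'

bits-< : ∀ {a b} → a < b → b < 2 → a ≡ 0 × b ≡ 1
bits-< {zero}  {suc zero}    _         _               = refl , refl
bits-< {suc _} {suc zero}    (s≤s ())  _
bits-< {_}     {suc (suc _)} _         (s≤s (s≤s ()))

differInLastBit : ∀ x x' → x / 2 ≡ x' / 2 → x < x' → HighestDifferingBit x x'
differInLastBit x x' halves≡ x<x' = record
  { j = 0 ; high = x / 2 ; low = 0 ; low' = 0 ; low< = s≤s z≤n ; low'< = s≤s z≤n
  ; x≡  = trans (halve x) (trans (cong (_+ 2 * (x / 2)) x%2≡0) (even (x / 2)))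
  ; x'≡ = trans (halve x') (trans (cong₂ (λ r q → r + 2 * q) x'%2≡1 (sym halves≡)) (odd (x / 2))) }
  where
  lowBits< : x % 2 < x' % 2
  lowBits< = +-cancelʳ-< (2 * (x / 2)) (x % 2) (x' % 2)
    (subst₂ _<_ (halve x) (trans (halve x') (cong (λ q → x' % 2 + 2 * q) (sym halves≡))) x<x')
  x%2≡0 : x % 2 ≡ 0
  x%2≡0 = proj₁ (bits-< lowBits< (m%n<n x' 2))
  x'%2≡1 : x' % 2 ≡ 1
  x'%2≡1 = proj₂ (bits-< lowBits< (m%n<n x' 2))
  even : ∀ q → 0 + 2 * q ≡ q * (2 * 1) + 0
  even = solve-∀
  odd : ∀ q → 1 + 2 * q ≡ q * (2 * 1) + 1 + 0
  odd = solve-∀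

differAboveLastBit : ∀ x x' → HighestDifferingBit (x / 2) (x' / 2) → HighestDifferingBit x x'
differAboveLastBit x x' d = record
  { j = suc j ; high = high ; low = x % 2 + 2 * low ; low' = x' % 2 + 2 * low'
  ; low< = c+2w<2p (m%n<n x 2) low< ; low'< = c+2w<2p (m%n<n x' 2) low'<
  ; x≡  = trans (halve x) (trans (cong (λ q → x % 2 + 2 * q) x≡) (appendˡ high (2 ^ j) (x % 2) low))
  ; x'≡ = trans (halve x') (trans (cong (λ q → x' % 2 + 2 * q) x'≡) (appendʳ high (2 ^ j) (x' % 2) low')) }
  where
  open HighestDifferingBit d
  appendˡ : ∀ h p r l → r + 2 * (h * (2 * p) + l) ≡ h * (2 * (2 * p)) + (r + 2 * l)
  appendˡ = solve-∀
  appendʳ : ∀ h p r l → r + 2 * (h * (2 * p) + p + l) ≡ h * (2 * (2 * p)) + 2 * p + (r + 2 * l)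
  appendʳ = solve-∀

highestDifferingBit : ∀ x x' → x < x' → HighestDifferingBit x x'
highestDifferingBit = halving-induction₂ (λ x x' → x < x' → HighestDifferingBit x x') (λ ()) step
  where
  step : ∀ x x' → (x / 2 < x' / 2 → HighestDifferingBit (x / 2) (x' / 2)) → x < x' → HighestDifferingBit x x'
  step x x' ih x<x' with m≤n⇒m<n∨m≡n (/-monoˡ-≤ 2 (<⇒≤ x<x'))
  ... | inj₁ halves< = differAboveLastBit x x' (ih halves<)
  ... | inj₂ halves≡ = differInLastBit x x' halves≡ x<x'

<2^j⇒<2^[1+j] : ∀ j {a} → a < 2 ^ j → a < 2 ^ suc j
<2^j⇒<2^[1+j] j a< = <-trans a< (2^j<2^[1+j] j)

n≤1*n+m : ∀ n m → n ≤ 1 * n + m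
n≤1*n+m n m = ≤-trans (≤-reflexive (sym (*-identityˡ n))) (m≤m+n (1 * n) m)

⊕-differing : ∀ {x x'} (d : HighestDifferingBit x x') →
  let open HighestDifferingBit d in x' ⊕ x ≡ 2 ^ j + (low' ⊕ low)
⊕-differing {x} {x'} d = begin
  x' ⊕ x                                                 ≡⟨ cong₂ _⊕_ x'≡ x≡ ⟩
  (high * 2 ^ suc j + 2 ^ j + low') ⊕ (high * 2 ^ suc j + low)
    ≡⟨ cong (_⊕ (high * 2 ^ suc j + low)) (+-assoc (high * 2 ^ suc j) (2 ^ j) low') ⟩
  (high * 2 ^ suc j + (2 ^ j + low')) ⊕ (high * 2 ^ suc j + low)
    ≡⟨ ⊕-split (suc j) high high (2^j+a<2^[1+j] j low'<) (<2^j⇒<2^[1+j] j low<) ⟩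
  (high ⊕ high) * 2 ^ suc j + ((2 ^ j + low') ⊕ low)
    ≡⟨ cong (λ h → h * 2 ^ suc j + ((2 ^ j + low') ⊕ low)) (⊕-self high) ⟩
  (2 ^ j + low') ⊕ low                                   ≡⟨ cong (λ n → (n + low') ⊕ low) (*-identityˡ (2 ^ j)) ⟨
  (1 * 2 ^ j + low') ⊕ (0 * 2 ^ j + low)
    ≡⟨ ⊕-split j 1 0 low'< low< ⟩
  1 * 2 ^ j + (low' ⊕ low)                               ≡⟨ cong (_+ (low' ⊕ low)) (*-identityˡ (2 ^ j)) ⟩
  2 ^ j + (low' ⊕ low)                                   ∎
  where
  open HighestDifferingBit d
  open ≡-Reasoning

2^i+p<2^j+q : ∀ {i j p} q → i < j → p < 2 ^ i → 2 ^ i + p < 2 ^ j + q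
2^i+p<2^j+q {i} {j} {p} q i<j p< = begin-strict
  2 ^ i + p   <⟨ 2^j+a<2^[1+j] i p< ⟩
  2 ^ suc i   ≤⟨ ^-monoʳ-≤ 2 i<j ⟩
  2 ^ j       ≤⟨ m≤m+n (2 ^ j) q ⟩
  2 ^ j + q   ∎
  where open ≤-Reasoning

leadingBit-unique : ∀ {i j p q} → p < 2 ^ i → q < 2 ^ j → 2 ^ i + p ≡ 2 ^ j + q → i ≡ j
leadingBit-unique {i} {j} {p} {q} p< q< eq with <-cmp i j
... | tri< i<j _ _ = contradiction eq (<⇒≢ (2^i+p<2^j+q q i<j p<))
... | tri≈ _ i≡j _ = i≡j
... | tri> _ _ j<i = contradiction (sym eq) (<⇒≢ (2^i+p<2^j+q p j<i q<))

bit·2^j+c<2^[1+j] : ∀ j {b c} → Bit b → c < 2 ^ j → b * 2 ^ j + c < 2 ^ suc j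
bit·2^j+c<2^[1+j] j 0ᵇ c< = <-≤-trans c< (m≤m+n (2 ^ j) _)
bit·2^j+c<2^[1+j] j 1ᵇ c< = subst (λ n → n + _ < 2 ^ suc j) (sym (*-identityˡ (2 ^ j))) (2^j+a<2^[1+j] j c<)

record BitSplit (j x : ℕ) : Set where
  constructor split
  field
    high mid low : ℕ
    midBit : Bit mid
    low<   : low < 2 ^ j
    x≡     : x ≡ high * 2 ^ suc j + (mid * 2 ^ j + low)

bitSplit : ∀ j x → BitSplit j x
bitSplit j x = split (x / 2 ^ suc j) (r / 2 ^ j) (r % 2 ^ j) (<2⇒Bit (m<n*o⇒m/o<n (m%n<n x (2 ^ suc j)))) (m%n<n r (2 ^ j))
  (trans (m≡[m/n]*n+m%n x (2 ^ suc j)) (cong (_+_ (x / 2 ^ suc j * 2 ^ suc j)) (m≡[m/n]*n+m%n r (2 ^ j))))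
  where
  instance
    2^j-nonZero : NonZero (2 ^ j)
    2^j-nonZero = m^n≢0 2 j
    2^[1+j]-nonZero : NonZero (2 ^ suc j)
    2^[1+j]-nonZero = m^n≢0 2 (suc j)
  r : ℕ
  r = x % 2 ^ suc j

⊕-bitSplit : ∀ j {x x'} (sx : BitSplit j x) (sx' : BitSplit j x') →
  let open BitSplit in
  x ⊕ x' ≡ (high sx ⊕ high sx') * 2 ^ suc j + ((mid sx ⊕ mid sx') * 2 ^ j + (low sx ⊕ low sx'))
⊕-bitSplit j (split h β c βbit c< x≡) (split h' β' c' βbit' c'< x'≡) =
  trans (cong₂ _⊕_ x≡ x'≡)
    (trans (⊕-split (suc j) h h' (bit·2^j+c<2^[1+j] j βbit c<) (bit·2^j+c<2^[1+j] j βbit' c'<))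
      (cong (_+_ ((h ⊕ h') * 2 ^ suc j)) (⊕-split j β β' c< c'<)))

nimMove< : ∀ j {y t u B A c a d} → y ≡ B * 2 ^ suc j + (1 * 2 ^ j + c) → t ≡ A * 2 ^ suc j + (0 * 2 ^ j + a) →
  u ≡ (B ⊕ A) * 2 ^ suc j + d → a < 2 ^ j → d < 2 ^ j → u ⊕ t < y
nimMove< j {y} {t} {u} {B} {A} {c} {a} {d} y≡ t≡ u≡ a< d< = begin-strict
  u ⊕ t                                         ≡⟨ cong₂ _⊕_ u≡ t≡ ⟩
  ((B ⊕ A) * 2 ^ suc j + d) ⊕ (A * 2 ^ suc j + a)
    ≡⟨ ⊕-split (suc j) (B ⊕ A) A (<2^j⇒<2^[1+j] j d<) (<2^j⇒<2^[1+j] j a<) ⟩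
  ((B ⊕ A) ⊕ A) * 2 ^ suc j + (d ⊕ a)           ≡⟨ cong (λ h → h * 2 ^ suc j + (d ⊕ a)) (⊕-cancelʳ B A) ⟩
  B * 2 ^ suc j + (d ⊕ a)                       <⟨ +-monoʳ-< (B * 2 ^ suc j) (⊕-<-2^ j d< a<) ⟩
  B * 2 ^ suc j + 2 ^ j                         ≤⟨ +-monoʳ-≤ (B * 2 ^ suc j) (n≤1*n+m (2 ^ j) c) ⟩
  B * 2 ^ suc j + (1 * 2 ^ j + c)               ≡⟨ y≡ ⟨
  y                                             ∎
  where open ≤-Reasoning

injective⇒surjective : ∀ n (f : ℕ → ℕ) → (∀ {e} → e < n → f e < n) →
  (∀ {e e'} → e < n → e' < n → f e ≡ f e' → e ≡ e') →
  ∀ {d} → d < n → ∃[ e ] e < n × f e ≡ d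
injective⇒surjective (suc n) f maps inj {d} d<n = byCases (any? λ i → F i ≟ᶠ fromℕ< d<n)
  where
  F : Fin (suc n) → Fin (suc n)
  F i = fromℕ< (maps (toℕ<n i))
  toℕ-F : ∀ i → toℕ (F i) ≡ f (toℕ i)
  toℕ-F i = toℕ-fromℕ< _
  avoids : ¬ (∃ λ i → F i ≡ fromℕ< d<n) → ∀ i → fromℕ< d<n ≢ F i
  avoids d∉F i d≡Fi = d∉F (i , sym d≡Fi)
  byCases : Dec (∃ λ i → F i ≡ fromℕ< d<n) → ∃[ e ] e < suc n × f e ≡ d
  byCases (yes (i , Fi≡d)) = toℕ i , toℕ<n i , trans (sym (toℕ-F i)) (trans (cong toℕ Fi≡d) (toℕ-fromℕ< d<n))
  byCases (no d∉F) with i , i' , i<i' , collide ← pigeonhole (n<1+n n) (λ i → punchOut (avoids d∉F i)) =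
    contradiction (inj (toℕ<n i) (toℕ<n i') f-collide) (<⇒≢ i<i')
    where
    f-collide : f (toℕ i) ≡ f (toℕ i')
    f-collide = trans (sym (toℕ-F i))
      (trans (cong toℕ (punchOut-injective (avoids d∉F i) (avoids d∉F i') collide)) (toℕ-F i'))

injective⇒surjective-from : ∀ lo n (f : ℕ → ℕ) →
  (∀ {e} → lo ≤ e → e < n → lo ≤ f e × f e < n) →
  (∀ {e e'} → lo ≤ e → e < n → lo ≤ e' → e' < n → f e ≡ f e' → e ≡ e') →
  ∀ {d} → lo ≤ d → d < n → ∃[ e ] lo ≤ e × e < n × f e ≡ d
injective⇒surjective-from lo n f maps inj {d} lo≤d d<n =
  unshift (injective⇒surjective (n ∸ lo) g g-maps g-inj (∸-monoˡ-< d<n lo≤d))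
  where
  lo≤n : lo ≤ n
  lo≤n = ≤-trans lo≤d (<⇒≤ d<n)
  g : ℕ → ℕ
  g e = f (lo + e) ∸ lo
  shift< : ∀ {e} → e < n ∸ lo → lo + e < n
  shift< {e} e< = subst (lo + e <_) (m+[n∸m]≡n lo≤n) (+-monoʳ-< lo e<)
  lo≤f : ∀ {e} → e < n ∸ lo → lo ≤ f (lo + e)
  lo≤f {e} e< = proj₁ (maps (m≤m+n lo e) (shift< e<))
  g-maps : ∀ {e} → e < n ∸ lo → g e < n ∸ lo
  g-maps {e} e< = ∸-monoˡ-< (proj₂ (maps (m≤m+n lo e) (shift< e<))) (lo≤f e<)
  g-inj : ∀ {e e'} → e < n ∸ lo → e' < n ∸ lo → g e ≡ g e' → e ≡ e'
  g-inj {e} {e'} e< e'< eq = +-cancelˡ-≡ lo e e'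
    (inj (m≤m+n lo e) (shift< e<) (m≤m+n lo e') (shift< e'<) (∸-cancelʳ-≡ (lo≤f e<) (lo≤f e'<) eq))
  unshift : ∃[ e ] e < n ∸ lo × g e ≡ d ∸ lo → ∃[ e ] lo ≤ e × e < n × f e ≡ d
  unshift (e , e< , ge≡) = lo + e , m≤m+n lo e , shift< e< , ∸-cancelʳ-≡ (lo≤f e<) lo≤d ge≡

-- Grundy values

mexFrom-spec : ∀ fuel n {m l} → n ≤ m → m < n + fuel → m ∉ l → (∀ {u} → n ≤ u → u < m → u ∈ l) →
  mexFrom fuel n l ≡ m
mexFrom-spec zero n n≤m m< _ _ = contradiction (subst (_≤ _) (sym (+-identityʳ n)) n≤m) (<⇒≱ m<)
mexFrom-spec (suc fuel) n {m} {l} n≤m m< m∉l below with n ∈? l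
... | yes n∈l = mexFrom-spec fuel (suc n) (≤∧≢⇒< n≤m λ { refl → m∉l n∈l }) (subst (m <_) (+-suc n fuel) m<) m∉l
                  (below ∘ <⇒≤)
... | no n∉l with m≤n⇒m<n∨m≡n n≤m
...   | inj₁ n<m = contradiction (below ≤-refl n<m) n∉l
...   | inj₂ n≡m = n≡m

mex-spec : ∀ {m} l → m ≤ length l → m ∉ l → (∀ {u} → u < m → u ∈ l) → mex l ≡ m
mex-spec l m≤ m∉l below = mexFrom-spec (suc (length l)) 0 z≤n (s≤s m≤) m∉l λ _ → below

zip-applyUpTo : ∀ {A B : Set} (a : ℕ → A) (b : ℕ → B) n →
  zip (applyUpTo a n) (applyUpTo b n) ≡ applyUpTo (λ i → a i , b i) n
zip-applyUpTo a b zero    = refl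
zip-applyUpTo a b (suc n) = cong ((a 0 , b 0) ∷_) (zip-applyUpTo (a ∘ suc) (b ∘ suc) n)

module _ (f : ℕ → ℕ) where

  vertical-applyUpTo : ∀ prev y → vertical f prev y ≡ applyUpTo (column f prev) y
  vertical-applyUpTo prev zero    = refl
  vertical-applyUpTo prev (suc y) =
    trans (cong (_++ [ column f prev y ]) (vertical-applyUpTo prev y)) (applyUpTo-∷ʳ (column f prev) y)

  columns-applyUpTo : ∀ z → columns f z ≡ applyUpTo (λ w → column f (columns f w)) z
  columns-applyUpTo zero    = refl
  columns-applyUpTo (suc z) =
    trans (cong (_++ [ column f (columns f z) ]) (columns-applyUpTo z)) (applyUpTo-∷ʳ _ z)

  horizontal-applyUpTo : ∀ y z → horizontal f (columns f z) y ≡ applyUpTo (λ w → G f (y ⊓ f w) w) z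
  horizontal-applyUpTo y z rewrite columns-applyUpTo z | length-applyUpTo (λ w → column f (columns f w)) z
    | zip-applyUpTo (λ i → i) (λ w → column f (columns f w)) z = map-applyUpTo _ _ z

  verticalOptions horizontalOptions : ℕ → ℕ → List ℕ
  verticalOptions   y z = applyUpTo (λ v → G f v z) y
  horizontalOptions y z = applyUpTo (λ w → G f (y ⊓ f w) w) z

  G≡mex : ∀ y z → G f y z ≡ mex (verticalOptions y z ++ horizontalOptions y z)
  G≡mex y z = cong mex (cong₂ _++_ (vertical-applyUpTo (columns f z) y) (horizontal-applyUpTo y z))

  record IsGrundyLabelling (F : ℕ → ℕ → ℕ) : Set where
    field
      -- mex only searches up to the length of its list, the number of options.
      bounded      : ∀ {y z} → y ≤ f z → F y z ≤ y + z
      vertical-≢   : ∀ {y z v} → y ≤ f z → v < y → F v z ≢ F y z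
      horizontal-≢ : ∀ {y z w} → y ≤ f z → w < z → F (y ⊓ f w) w ≢ F y z
      complete     : ∀ {y z u} → y ≤ f z → u < F y z →
                     (∃[ v ] v < y × F v z ≡ u) ⊎ (∃[ w ] w < z × F (y ⊓ f w) w ≡ u)

  IsGrundyLabelling⇒G≡ : ∀ {F} → IsGrundyLabelling F → ∀ {y z} → y ≤ f z → G f y z ≡ F y z
  IsGrundyLabelling⇒G≡ {F} isGrundy {y} {z} = <-rec (λ z → ∀ y → y ≤ f z → G f y z ≡ F y z) byColumn z y
    where
    open IsGrundyLabelling isGrundy
    byColumn : ∀ z → (∀ {w} → w < z → ∀ y → y ≤ f w → G f y w ≡ F y w) → ∀ y → y ≤ f z → G f y z ≡ F y z
    byColumn z G≡F← = <-rec (λ y → y ≤ f z → G f y z ≡ F y z) byRow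
      where
      byRow : ∀ y → (∀ {v} → v < y → v ≤ f z → G f v z ≡ F v z) → y ≤ f z → G f y z ≡ F y z
      byRow y G≡F↓ y≤ = trans (G≡mex y z) (mex-spec (verticalOptions y z ++ horizontalOptions y z) F≤length F∉ below)
        where
        G↓ : ∀ {v} → v < y → G f v z ≡ F v z
        G↓ v<y = G≡F↓ v<y (≤-trans (<⇒≤ v<y) y≤)
        G← : ∀ {w} → w < z → G f (y ⊓ f w) w ≡ F (y ⊓ f w) w
        G← {w} w<z = G≡F← w<z (y ⊓ f w) (m⊓n≤n y (f w))
        F≤length : F y z ≤ length (verticalOptions y z ++ horizontalOptions y z)
        F≤length = subst (F y z ≤_)
          (sym (trans (length-++ (verticalOptions y z)) (cong₂ _+_ (length-applyUpTo _ y) (length-applyUpTo _ z))))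
          (bounded y≤)
        F∉ : F y z ∉ verticalOptions y z ++ horizontalOptions y z
        F∉ p with ∈-++⁻ (verticalOptions y z) p
        ... | inj₁ p↓ = let v , v<y , eq = ∈-applyUpTo⁻ _ p↓ in vertical-≢ y≤ v<y (sym (trans eq (G↓ v<y)))
        ... | inj₂ p← = let w , w<z , eq = ∈-applyUpTo⁻ _ p← in horizontal-≢ y≤ w<z (sym (trans eq (G← w<z)))
        below : ∀ {u} → u < F y z → u ∈ verticalOptions y z ++ horizontalOptions y z
        below u< with complete y≤ u<
        ... | inj₁ (v , v<y , eq) = ∈-++⁺ˡ (subst (_∈ verticalOptions y z) (trans (G↓ v<y) eq) (∈-applyUpTo⁺ _ v<y))
        ... | inj₂ (w , w<z , eq) = ∈-++⁺ʳ (verticalOptions y z)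
                                      (subst (_∈ horizontalOptions y z) (trans (G← w<z) eq) (∈-applyUpTo⁺ _ w<z))

-- The chocolate bar game with h_s(z) = ⌊(z + s)/2k⌋

module Width (k : ℕ) .{{_ : NonZero k}} where

  K : ℕ
  K = 2 * k

  instance
    K-nonZero : NonZero K
    K-nonZero = m*n≢0 2 k

  m+y≤t : ∀ {m y t} → m < K → m ≤ t → y * K ≤ t → m + y ≤ t
  m+y≤t {m} {zero}  {t} _ m≤t _ = subst (_≤ t) (sym (+-identityʳ m)) m≤t
  m+y≤t {m} {suc y} {t} m<K _ yK≤t = begin
    m + suc y       ≡⟨ +-suc m y ⟩
    suc m + y       ≤⟨ +-monoˡ-≤ y m<K ⟩
    K + y           ≤⟨ +-monoʳ-≤ K (m≤m*n y K) ⟩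
    suc y * K       ≤⟨ yK≤t ⟩
    t               ∎
    where open ≤-Reasoning

  s≤⊕ : ∀ {m} v {y t} → m < K → m * 2 ^ v ≤ t → y ≤ t / K → m * 2 ^ v ≤ y ⊕ t
  s≤⊕ {m} v {y} {t} m<K s≤t y≤ = begin
    m * P
      ≤⟨ *-monoˡ-≤ P (m+y≤t⇒m≤y⊕t {m} {y / P} (m+y≤t m<K (*≤⇒≤/ P s≤t) yK≤t)) ⟩
    (y / P ⊕ t / P) * P                       ≤⟨ m≤m+n _ _ ⟩
    (y / P ⊕ t / P) * P + (y % P ⊕ t % P)     ≡⟨ ⊕-split v (y / P) (t / P) (m%n<n y P) (m%n<n t P) ⟨
    (y / P * P + y % P) ⊕ (t / P * P + t % P) ≡⟨ cong₂ _⊕_ (m≡[m/n]*n+m%n y P) (m≡[m/n]*n+m%n t P) ⟨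
    y ⊕ t                                     ∎
    where
    open ≤-Reasoning
    P : ℕ
    P = 2 ^ v
    instance
      P-nonZero : NonZero P
      P-nonZero = m^n≢0 2 v
    yK≤t : y / P * K ≤ t / P
    yK≤t = *≤⇒≤/ P (begin
      y / P * K * P   ≡⟨ *-rightComm (y / P) K P ⟩
      y / P * P * K   ≤⟨ *-monoˡ-≤ K (m/n*n≤m y P) ⟩
      y * K           ≤⟨ ≤/⇒*≤ K y≤ ⟩
      t               ∎)

  topHalf≤/ : ∀ j {Y X t'} → (Y * 2 ^ suc j + 2 ^ j) * K < suc X * 2 ^ suc j →
    X * 2 ^ suc j ≤ t' → Y * 2 ^ suc j + 2 ^ j ≤ t' / K
  topHalf≤/ j {Y} {X} {t'} lt X≤ = *≤⇒≤/ K (begin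
    (Y * 2 ^ suc j + 2 ^ j) * K   ≡⟨ multipleOf2^[1+j] ⟩
    (Y * K + k) * 2 ^ suc j
      ≤⟨ *-monoˡ-≤ (2 ^ suc j) (m*o<[1+n]*o⇒m≤n (2 ^ suc j) {Y * K + k} {X}
           (subst (_< suc X * 2 ^ suc j) multipleOf2^[1+j] lt)) ⟩
    X * 2 ^ suc j                 ≤⟨ X≤ ⟩
    t'                            ∎)
    where
    open ≤-Reasoning
    multipleOf2^[1+j] : (Y * 2 ^ suc j + 2 ^ j) * K ≡ (Y * K + k) * 2 ^ suc j
    multipleOf2^[1+j] = lemma Y (2 ^ j) k
      where
      lemma : ∀ Y p k → (Y * (2 * p) + p) * (2 * k) ≡ (Y * (2 * k) + k) * (2 * p)
      lemma = solve-∀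

  differingBits-≢ : ∀ {y t t'} → y ≤ t / K → (dt : HighestDifferingBit t' t) (dy : HighestDifferingBit (t' / K) y) →
    HighestDifferingBit.j dy ≢ HighestDifferingBit.j dt
  differingBits-≢ {y} {t} {t'} y≤ (differ j X b a b< a< t'≡ t≡) (differ .j Y e c e< c< y'≡ y≡) refl =
    <⇒≱ (subst (_< Y * 2 ^ suc j + 2 ^ j) (sym y'≡) (+-monoʳ-< (Y * 2 ^ suc j) e<))
        (topHalf≤/ j {Y} {X} yTop·K<t X·Q≤t')
    where
    open ≤-Reasoning
    X·Q≤t' : X * 2 ^ suc j ≤ t'
    X·Q≤t' = subst (X * 2 ^ suc j ≤_) (sym t'≡) (m≤m+n _ b)
    yTop·K<t : (Y * 2 ^ suc j + 2 ^ j) * K < suc X * 2 ^ suc j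
    yTop·K<t = begin-strict
      (Y * 2 ^ suc j + 2 ^ j) * K      ≤⟨ *-monoˡ-≤ K (subst (Y * 2 ^ suc j + 2 ^ j ≤_) (sym y≡) (m≤m+n _ c)) ⟩
      y * K                            ≤⟨ ≤/⇒*≤ K y≤ ⟩
      t                                ≡⟨ t≡ ⟩
      X * 2 ^ suc j + 2 ^ j + a        <⟨ +-monoʳ-< (X * 2 ^ suc j + 2 ^ j) a< ⟩
      X * 2 ^ suc j + 2 ^ j + 2 ^ j    ≡⟨ lemma X (2 ^ j) ⟩
      suc X * 2 ^ suc j                ∎
      where
      lemma : ∀ X p → X * (2 * p) + p + p ≡ suc X * (2 * p)
      lemma = solve-∀

  ⊕-move-≢ : ∀ {y t t'} → y ≤ t / K → t' < t → (y ⊓ (t' / K)) ⊕ t' ≢ y ⊕ t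
  ⊕-move-≢ {y} {t} {t'} y≤ t'<t eq with y ≤? t' / K
  ... | yes y≤' = <⇒≢ t'<t (⊕-injectiveʳ y (trans (cong (_⊕ t') (sym (m≤n⇒m⊓n≡m y≤'))) eq))
  ... | no y≰' = differingBits-≢ y≤ dt dy sameBit
    where
    dt : HighestDifferingBit t' t
    dt = highestDifferingBit t' t t'<t
    dy : HighestDifferingBit (t' / K) y
    dy = highestDifferingBit (t' / K) y (≰⇒> y≰')
    eq' : t' / K ⊕ t' ≡ y ⊕ t
    eq' = trans (cong (_⊕ t') (sym (m≥n⇒m⊓n≡n (≰⇒≥ y≰')))) eq
    open HighestDifferingBit
    sameBit : j dy ≡ j dt
    sameBit = leadingBit-unique (⊕-<-2^ (j dy) (low'< dy) (low< dy)) (⊕-<-2^ (j dt) (low'< dt) (low< dt))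
      (trans (sym (⊕-differing dy)) (trans (⊕-exchange {t' / K} {t'} {y} {t} eq') (⊕-differing dt)))

  ⊓-shrink : ∀ y {t₁ t₂} → t₁ ≤ t₂ → (y ⊓ (t₂ / K)) ⊓ (t₁ / K) ≡ y ⊓ (t₁ / K)
  ⊓-shrink y {t₁} {t₂} le = trans (⊓-assoc y (t₂ / K) (t₁ / K)) (cong (y ⊓_) (m≥n⇒m⊓n≡n (/-monoˡ-≤ K le)))

  ⊕-move-injective : ∀ y {t₁ t₂} → (y ⊓ (t₁ / K)) ⊕ t₁ ≡ (y ⊓ (t₂ / K)) ⊕ t₂ → t₁ ≡ t₂
  ⊕-move-injective y {t₁} {t₂} eq with <-cmp t₁ t₂
  ... | tri< t₁<t₂ _ _ =
    contradiction (trans (cong (_⊕ t₁) (⊓-shrink y (<⇒≤ t₁<t₂))) eq) (⊕-move-≢ (m⊓n≤n y (t₂ / K)) t₁<t₂)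
  ... | tri≈ _ t₁≡t₂ _ = t₁≡t₂
  ... | tri> _ _ t₂<t₁ =
    contradiction (trans (cong (_⊕ t₂) (⊓-shrink y (<⇒≤ t₂<t₁))) (sym eq)) (⊕-move-≢ (m⊓n≤n y (t₁ / K)) t₂<t₁)

  s≤A·2^i : ∀ {m} v {t A} i → m < K → m * 2 ^ v ≤ t → t < suc A * 2 ^ i → K ≤ A → m * 2 ^ v ≤ A * 2 ^ i
  s≤A·2^i {m} v {t} {A} i m<K s≤t t< K≤A with i ≤? v
  ... | yes i≤v = subst (_≤ A * 2 ^ i) (sym s≡)
    (*-monoˡ-≤ (2 ^ i) (m*o<[1+n]*o⇒m≤n (2 ^ i) {m * 2 ^ (v ∸ i)} {A} (subst (_< suc A * 2 ^ i) s≡ (≤-<-trans s≤t t<))))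
    where
    s≡ : m * 2 ^ v ≡ m * 2 ^ (v ∸ i) * 2 ^ i
    s≡ = begin-equality
      m * 2 ^ v                  ≡⟨ cong (λ e → m * 2 ^ e) (m∸n+n≡m i≤v) ⟨
      m * 2 ^ (v ∸ i + i)        ≡⟨ cong (m *_) (^-distribˡ-+-* 2 (v ∸ i) i) ⟩
      m * (2 ^ (v ∸ i) * 2 ^ i)  ≡⟨ *-assoc m (2 ^ (v ∸ i)) (2 ^ i) ⟨
      m * 2 ^ (v ∸ i) * 2 ^ i    ∎
      where open ≤-Reasoning
  ... | no i≰v = begin
    m * 2 ^ v   ≤⟨ *-monoʳ-≤ m (^-monoʳ-≤ 2 (<⇒≤ (≰⇒> i≰v))) ⟩
    m * 2 ^ i   ≤⟨ *-monoˡ-≤ (2 ^ i) (≤-trans (<⇒≤ m<K) K≤A) ⟩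
    A * 2 ^ i   ∎
    where open ≤-Reasoning

  s∸A2^i≤s∸[B⊕A]2^i : ∀ {m} v {t A} i B → m < K → m * 2 ^ v ≤ t → t < suc A * 2 ^ i → B * K ≤ A →
    m * 2 ^ v ∸ A * 2 ^ i ≤ m * 2 ^ v ∸ (B ⊕ A) * 2 ^ i
  s∸A2^i≤s∸[B⊕A]2^i {m} v {t} {A} i zero _ _ _ _ = ≤-reflexive (cong (λ X → m * 2 ^ v ∸ X * 2 ^ i) (sym (⊕-identityˡ A)))
  s∸A2^i≤s∸[B⊕A]2^i {m} v {t} {A} i (suc B) m<K s≤t t< BK≤A =
    subst (_≤ m * 2 ^ v ∸ (suc B ⊕ A) * 2 ^ i)
      (sym (m≤n⇒m∸n≡0 (s≤A·2^i v i m<K s≤t t< (≤-trans (m≤m+n K (B * K)) BK≤A)))) z≤n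

  module HorizontalMoves {j y t A B c a : ℕ}
    (y≡ : y ≡ B * 2 ^ suc j + c) (c< : c < 2 ^ j)
    (t≡ : t ≡ A * 2 ^ suc j + (1 * 2 ^ j + a)) (a< : a < 2 ^ j)
    (y≤ : y ≤ t / K) where

    Q N : ℕ
    Q = 2 ^ suc j
    N = 2 ^ j

    tₑ yₑ cₑ : ℕ → ℕ
    tₑ e = A * Q + e
    yₑ e = y ⊓ (tₑ e / K)
    cₑ e = yₑ e ∸ B * Q

    t<[1+A]Q : t < suc A * Q
    t<[1+A]Q = subst (_< suc A * Q) (sym t≡)
      (subst (A * Q + (1 * N + a) <_) (+-comm (A * Q) Q) (+-monoʳ-< (A * Q) (bit·2^j+c<2^[1+j] j 1ᵇ a<)))

    BQ≤y : B * Q ≤ y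
    BQ≤y = subst (B * Q ≤_) (sym y≡) (m≤m+n (B * Q) c)

    BK≤A : B * K ≤ A
    BK≤A = m*o<[1+n]*o⇒m≤n Q (begin-strict
      B * K * Q   ≡⟨ *-rightComm B K Q ⟩
      B * Q * K   ≤⟨ *-monoˡ-≤ K BQ≤y ⟩
      y * K       ≤⟨ ≤/⇒*≤ K y≤ ⟩
      t           <⟨ t<[1+A]Q ⟩
      suc A * Q   ∎)
      where open ≤-Reasoning

    yₑ≡ : ∀ e → yₑ e ≡ B * Q + cₑ e
    yₑ≡ e = sym (m+[n∸m]≡n (⊓-glb BQ≤y (*≤⇒≤/ K (begin
      B * Q * K   ≡⟨ *-rightComm B Q K ⟩
      B * K * Q   ≤⟨ *-monoˡ-≤ Q BK≤A ⟩
      A * Q       ≤⟨ m≤m+n (A * Q) e ⟩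
      tₑ e        ∎))))
      where open ≤-Reasoning

    cₑ< : ∀ e → cₑ e < N
    cₑ< e = ≤-<-trans
      (subst (cₑ e ≤_) (m+n∸m≡n (B * Q) c) (∸-monoˡ-≤ (B * Q) (subst (yₑ e ≤_) y≡ (m⊓n≤m y (tₑ e / K))))) c<

    tₑ<t : ∀ {e} → e < N → tₑ e < t
    tₑ<t {e} e< = subst (tₑ e <_) (sym t≡) (+-monoʳ-< (A * Q) (<-≤-trans e< (n≤1*n+m N a)))

    value : ∀ {e} → e < N → yₑ e ⊕ tₑ e ≡ (B ⊕ A) * Q + (cₑ e ⊕ e)
    value {e} e< = trans (cong (_⊕ tₑ e) (yₑ≡ e)) (⊕-split (suc j) B A (<2^j⇒<2^[1+j] j (cₑ< e)) (<2^j⇒<2^[1+j] j e<))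

    -- The moves tₑ with lo ≤ e < 2^j are exactly those with tₑ ≥ s; their values are pairwise
    -- distinct and lie in [lo, 2^j), so one of them is u.
    reach : ∀ {m} v {u d} → m < K → m * 2 ^ v ≤ t → m * 2 ^ v ≤ u → u ≡ (B ⊕ A) * Q + d → d < N →
      ∃[ t' ] m * 2 ^ v ≤ t' × t' < t × (y ⊓ (t' / K)) ⊕ t' ≡ u
    reach {m} v {u} {d} m<K s≤t s≤u u≡ d< = found (injective⇒surjective-from lo N D maps inj (lo≤ (subst (s ≤_) u≡ s≤u)) d<)
      where
      s lo : ℕ
      s = m * 2 ^ v
      lo = s ∸ A * Q
      D : ℕ → ℕ
      D e = cₑ e ⊕ e
      s≤tₑ : ∀ {e} → lo ≤ e → s ≤ tₑ e
      s≤tₑ le = ≤-trans (m≤n+m∸n s (A * Q)) (+-monoʳ-≤ (A * Q) le)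
      lo≤ : ∀ {x} → s ≤ (B ⊕ A) * Q + x → lo ≤ x
      lo≤ {x} le = ≤-trans (s∸A2^i≤s∸[B⊕A]2^i v (suc j) B m<K s≤t t<[1+A]Q BK≤A) (m≤n+o⇒m∸n≤o s ((B ⊕ A) * Q) le)
      maps : ∀ {e} → lo ≤ e → e < N → lo ≤ D e × D e < N
      maps {e} le e< = lo≤ (subst (s ≤_) (value e<) (s≤⊕ v m<K (s≤tₑ le) (m⊓n≤n y (tₑ e / K)))) , ⊕-<-2^ j (cₑ< e) e<
      inj : ∀ {e e'} → lo ≤ e → e < N → lo ≤ e' → e' < N → D e ≡ D e' → e ≡ e'
      inj {e} {e'} _ e< _ e'< De≡De' = +-cancelˡ-≡ (A * Q) e e'
        (⊕-move-injective y (trans (value e<) (trans (cong (_+_ ((B ⊕ A) * Q)) De≡De') (sym (value e'<)))))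
      found : ∃[ e ] lo ≤ e × e < N × D e ≡ d → ∃[ t' ] s ≤ t' × t' < t × (y ⊓ (t' / K)) ⊕ t' ≡ u
      found (e , le , e< , De≡d) = tₑ e , s≤tₑ le , tₑ<t e< , trans (value e<) (trans (cong (_+_ ((B ⊕ A) * Q)) De≡d) (sym u≡))

  Reachable : ℕ → ℕ → ℕ → ℕ → Set
  Reachable s y t u = (∃[ w ] w < y × w ⊕ t ≡ u) ⊎ (∃[ t' ] s ≤ t' × t' < t × (y ⊓ (t' / K)) ⊕ t' ≡ u)

  below-reachable : ∀ {m} v {y t u} → m < K → m * 2 ^ v ≤ t → y ≤ t / K → m * 2 ^ v ≤ u → u < y ⊕ t →
    Reachable (m * 2 ^ v) y t u
  below-reachable {m} v {y} {t} {u} m<K s≤t y≤ s≤u u< = byTopBits (bitSplit j y) (bitSplit j t)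
    where
    open HighestDifferingBit (highestDifferingBit u (y ⊕ t) u<)
    Q N : ℕ
    Q = 2 ^ suc j
    N = 2 ^ j
    instance
      Q-nonZero : NonZero Q
      Q-nonZero = m^n≢0 2 (suc j)
    byTopBits : BitSplit j y → BitSplit j t → Reachable (m * 2 ^ v) y t u
    byTopBits sy@(split B β c βbit c< y≡) st@(split A β' a βbit' a< t≡) = byBits βbit βbit' y≡ t≡ (proj₂ highs)
      where
      highs : B ⊕ A ≡ high × (β ⊕ β') * N + (c ⊕ a) ≡ N + low'
      highs = quotRem-unique Q
        (bit·2^j+c<2^[1+j] j (<2⇒Bit (⊕-<-2^ 1 (Bit⇒<2 βbit) (Bit⇒<2 βbit'))) (⊕-<-2^ j c< a<)) (2^j+a<2^[1+j] j low'<)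
        (trans (sym (⊕-bitSplit j sy st)) (trans x'≡ (+-assoc (high * Q) N low')))
      u≡ : u ≡ (B ⊕ A) * Q + low
      u≡ = trans x≡ (cong (λ h → h * Q + low) (sym (proj₁ highs)))
      byBits : ∀ {β β'} → Bit β → Bit β' → y ≡ B * Q + (β * N + c) → t ≡ A * Q + (β' * N + a) →
        (β ⊕ β') * N + (c ⊕ a) ≡ N + low' → Reachable (m * 2 ^ v) y t u
      byBits 0ᵇ 0ᵇ _ _ low≡ = contradiction (⊕-<-2^ j c< a<) (≤⇒≯ (subst (N ≤_) (sym low≡) (m≤m+n N low')))
      byBits 1ᵇ 1ᵇ _ _ low≡ = contradiction (⊕-<-2^ j c< a<) (≤⇒≯ (subst (N ≤_) (sym low≡) (m≤m+n N low')))
      byBits 0ᵇ 1ᵇ y≡ t≡ _ =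
        inj₂ (HorizontalMoves.reach {j = j} {A = A} {B = B} y≡ c< t≡ a< y≤ v m<K s≤t s≤u u≡ low<)
      byBits 1ᵇ 0ᵇ y≡ t≡ _ = inj₁ (u ⊕ t , nimMove< j {B = B} {A = A} y≡ t≡ u≡ a< low< , ⊕-cancelʳ u t)

  module _ {m : ℕ} (v : ℕ) (m<K : m < K) where

    s : ℕ
    s = m * 2 ^ v

    s≤position : ∀ {y z} → y ≤ (z + s) / K → s ≤ y ⊕ (z + s)
    s≤position {y} {z} y≤ = s≤⊕ v m<K (m≤n+m s z) y≤

    F : ℕ → ℕ → ℕ
    F y z = (y ⊕ (z + s)) ∸ s

    f : ℕ → ℕ
    f z = (z + s) / K

    F-bounded : ∀ {y z} → y ≤ f z → F y z ≤ y + z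
    F-bounded {y} {z} _ = m≤n+o⇒m∸n≤o (y ⊕ (z + s)) s (≤-trans (⊕≤+ y (z + s)) (≤-reflexive rearrange))
      where
      rearrange : y + (z + s) ≡ s + (y + z)
      rearrange = trans (sym (+-assoc y z s)) (+-comm (y + z) s)

    F-vertical-≢ : ∀ {y z v'} → y ≤ f z → v' < y → F v' z ≢ F y z
    F-vertical-≢ {y} {z} {v'} y≤ v'<y eq =
      <⇒≢ v'<y (⊕-injectiveˡ (z + s) (∸-cancelʳ-≡ (s≤position (≤-trans (<⇒≤ v'<y) y≤)) (s≤position y≤) eq))

    F-horizontal-≢ : ∀ {y z w} → y ≤ f z → w < z → F (y ⊓ f w) w ≢ F y z
    F-horizontal-≢ {y} {z} {w} y≤ w<z eq =
      ⊕-move-≢ y≤ (+-monoˡ-< s w<z) (∸-cancelʳ-≡ (s≤position (m⊓n≤n y (f w))) (s≤position y≤) eq)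

    F-complete : ∀ {y z u} → y ≤ f z → u < F y z →
      (∃[ v' ] v' < y × F v' z ≡ u) ⊎ (∃[ w ] w < z × F (y ⊓ f w) w ≡ u)
    F-complete {y} {z} {u} y≤ u< = fromReach (below-reachable v m<K (m≤n+m s z) y≤ (m≤m+n s u)
                                       (subst (s + u <_) (m+[n∸m]≡n (s≤position y≤)) (+-monoʳ-< s u<)))
      where
      fromReach : Reachable s y (z + s) (s + u) → (∃[ v' ] v' < y × F v' z ≡ u) ⊎ (∃[ w ] w < z × F (y ⊓ f w) w ≡ u)
      fromReach (inj₁ (v' , v'<y , eq)) = inj₁ (v' , v'<y , trans (cong (_∸ s) eq) (m+n∸m≡n s u))
      fromReach (inj₂ (t' , s≤t' , t'<t , eq)) =
        inj₂ (t' ∸ s , subst (t' ∸ s <_) (m+n∸n≡m z s) (∸-monoˡ-< t'<t s≤t') , value)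
        where
        value : F (y ⊓ f (t' ∸ s)) (t' ∸ s) ≡ u
        value = begin
          ((y ⊓ ((t' ∸ s + s) / K)) ⊕ (t' ∸ s + s)) ∸ s
            ≡⟨ cong (λ t → ((y ⊓ (t / K)) ⊕ t) ∸ s) (m∸n+n≡m s≤t') ⟩
          ((y ⊓ (t' / K)) ⊕ t') ∸ s                   ≡⟨ cong (_∸ s) eq ⟩
          (s + u) ∸ s                                 ≡⟨ m+n∸m≡n s u ⟩
          u                                           ∎
          where open ≡-Reasoning

    nimLabelling : IsGrundyLabelling f F
    nimLabelling = record
      { bounded = F-bounded ; vertical-≢ = F-vertical-≢ ; horizontal-≢ = F-horizontal-≢ ; complete = F-complete }

oddPart : ∀ s → 1 ≤ s → ∃[ v ] ∃[ q ] s ≡ suc (2 * q) * 2 ^ v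
oddPart = halving-induction₁ (λ s → 1 ≤ s → ∃[ v ] ∃[ q ] s ≡ suc (2 * q) * 2 ^ v) (λ ()) step
  where
  step : ∀ s → (1 ≤ s / 2 → ∃[ v ] ∃[ q ] s / 2 ≡ suc (2 * q) * 2 ^ v) →
         1 ≤ s → ∃[ v ] ∃[ q ] s ≡ suc (2 * q) * 2 ^ v
  step s ih 1≤s with s % 2 | bit s | halve s
  ... | _ | 1ᵇ | s≡ = 0 , s / 2 , trans s≡ (sym (*-identityʳ _))
  ... | _ | 0ᵇ | s≡ with s / 2 | ih
  ...   | zero   | _  = contradiction s≡ (<⇒≢ 1≤s ∘ sym)
  ...   | suc h  | ih' with v , q , h≡ ← ih' (s≤s z≤n) = suc v , q , trans s≡ (trans (cong (2 *_) h≡) (lemma q (2 ^ v)))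
    where
    lemma : ∀ q p → 2 * (suc (2 * q) * p) ≡ suc (2 * q) * (2 * p)
    lemma = solve-∀

n<o⇒+m≢+n-+o : ∀ {m n o} → n < o → + m ≢ + n - + o
n<o⇒+m≢+n-+o {m} {n} {o} n<o eq with o ∸ n | m<n⇒0<n∸m n<o | trans eq (trans (m-n≡m⊖n n o) (⊖-< n<o))
... | suc _ | _ | ()

NimFormula : ℕ → ℕ → Set
NimFormula k s = (y z : ℕ) → y ≤ hs k s z → + G (hs k s) y z ≡ + (y ⊕ (z + s)) - + s

nimFormula-sufficient : ∀ k .{{_ : NonZero k}} {m} v → m < 2 * k → NimFormula k (m * 2 ^ v)
nimFormula-sufficient k@(suc _) {m} v m<K y z y≤ = begin
  + G (hs k s) y z               ≡⟨ cong +_ (IsGrundyLabelling⇒G≡ (hs k s) (nimLabelling v m<K) y≤) ⟩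
  + ((y ⊕ (z + s)) ∸ s)          ≡⟨ ⊖-≥ (s≤position v m<K y≤) ⟨
  (y ⊕ (z + s)) ⊖ s              ≡⟨ m-n≡m⊖n (y ⊕ (z + s)) s ⟨
  + (y ⊕ (z + s)) - + s          ∎
  where
  open Width k using (nimLabelling; s≤position)
  open ≡-Reasoning
  s : ℕ
  s = m * 2 ^ v

nimFormula-necessary : ∀ k .{{_ : NonZero k}} {s} → 1 ≤ s → NimFormula k s → ∃[ v ] ∃[ m ] m < 2 * k × s ≡ m * 2 ^ v
nimFormula-necessary k@(suc _) {s} 1≤s formula with oddPart s 1≤s
... | v , q , s≡ with suc (2 * q) <? 2 * k
...   | yes m<2k = v , suc (2 * q) , m<2k , s≡
...   | no m≮2k = contradiction (formula (2 ^ v) 0 2^v≤s/2k) (n<o⇒+m≢+n-+o 2^v⊕s<s)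
  where
  open ≤-Reasoning
  2^v≤s/2k : 2 ^ v ≤ s / (2 * k)
  2^v≤s/2k = *≤⇒≤/ (2 * k) (begin
    2 ^ v * (2 * k)       ≤⟨ *-monoʳ-≤ (2 ^ v) (≮⇒≥ m≮2k) ⟩
    2 ^ v * suc (2 * q)   ≡⟨ *-comm (2 ^ v) (suc (2 * q)) ⟩
    suc (2 * q) * 2 ^ v   ≡⟨ s≡ ⟨
    s                     ∎)
  s≡q2^[1+v]+2^v : s ≡ q * 2 ^ suc v + 2 ^ v
  s≡q2^[1+v]+2^v = trans s≡ (lemma q (2 ^ v))
    where
    lemma : ∀ q p → suc (2 * q) * p ≡ q * (2 * p) + p
    lemma = solve-∀
  2^v⊕s<s : 2 ^ v ⊕ s < s
  2^v⊕s<s = begin-strict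
    2 ^ v ⊕ s                                 ≡⟨ cong (2 ^ v ⊕_) s≡q2^[1+v]+2^v ⟩
    (0 * 2 ^ suc v + 2 ^ v) ⊕ (q * 2 ^ suc v + 2 ^ v)
      ≡⟨ ⊕-split (suc v) 0 q (2^j<2^[1+j] v) (2^j<2^[1+j] v) ⟩
    (0 ⊕ q) * 2 ^ suc v + (2 ^ v ⊕ 2 ^ v)    ≡⟨ cong₂ (λ a b → a * 2 ^ suc v + b) (⊕-identityˡ q) (⊕-self (2 ^ v)) ⟩
    q * 2 ^ suc v + 0                         <⟨ +-monoʳ-< (q * 2 ^ suc v) (m^n>0 2 v) ⟩
    q * 2 ^ suc v + 2 ^ v                     ≡⟨ s≡q2^[1+v]+2^v ⟨
    s                                         ∎

mainTheorem6 : (k s : ℕ) → 1 ≤ k → 1 ≤ s →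
    (Σ ℕ (λ v → Σ ℕ (λ m → m < 2 * k × s ≡ m * 2 ^ v)))
    ⇔ ((y z : ℕ) → y ≤ hs k s z →
         + G (hs k s) y z ≡ + (y ⊕ (z + s)) - + s)
mainTheorem6 k@(suc _) s _ 1≤s = mk⇔
  (λ (v , m , m<2k , s≡) → subst (NimFormula k) (sym s≡) (nimFormula-sufficient k v m<2k))
  (nimFormula-necessary k 1≤s)
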